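{- Let $p\ge 3$ be an integer, let $G$ be a connected graph containing no induced $P_5$ and no induced $K_p-e$, and suppose $G$ has no clique separators. Let $Q$ be a maximum clique of $G$. Then $G$ is $O_3$-free (i.e., $G$ has no independent set of three vertices) or $|Q|\le (p+1)^{p+2}(p-2)$.
   Context: $P_5$ is the path on five vertices; $K_p-e$ is the graph obtained from the complete graph $K_p$ by deleting one edge; $O_3$ is the edgeless graph on three vertices. "Induced $H$" means an induced subgraph isomorphic to $H$. A clique separator is a clique whose removal increases the number of connected components. -}

module Defs where

open import Data.Nat using (ℕ; zero; suc; _+_; _∸_; _≤_)
open import Data.Fin using (Fin; toℕ)
open import Data.Fin.Subset using (Subset; _∈_; _∉_; ⊥; ∣_∣)
open import Data.Product using (Σ; _×_; ∃; _,_)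
open import Relation.Nullary using (¬_; Dec)
open import Relation.Binary.PropositionalEquality using (_≡_; _≢_)
open import Function.Definitions using (Injective)
open import Data.Sum using (_⊎_)
open import Data.Empty using () renaming (⊥ to Empty)
open import Data.Unit using (⊤)
open import Function.Bundles using (_⇔_)

record Graph : Set₁ where
  field
    size   : ℕ
    Adj    : Fin size → Fin size → Set
    adj?   : ∀ u v → Dec (Adj u v)
    sym    : ∀ {u v} → Adj u v → Adj v u
    irrefl : ∀ {u} → ¬ Adj u u
open Graph public

HasInduced : Graph → Graph → Set
HasInduced H G =
  Σ (Fin (size H) → Fin (size G)) λ f →
    Injective _≡_ _≡_ f × (∀ i j → Adj H i j ⇔ Adj G (f i) (f j))

Free : Graph → Graph → Set
Free H G = ¬ HasInduced H G

P5Adj : Fin 5 → Fin 5 → Set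
P5Adj i j = (suc (toℕ i) ≡ toℕ j) ⊎ (suc (toℕ j) ≡ toℕ i)

-- Complete graph K_p minus the edge {0,1}: distinct i,j adjacent unless {i,j} = {0,1}.
KpeAdj : (p : ℕ) → Fin p → Fin p → Set
KpeAdj p i j = (i ≢ j) × ¬ ((toℕ i + toℕ j ≡ 1))

O3Adj : Fin 3 → Fin 3 → Set
O3Adj _ _ = Empty

data PathAvoiding (G : Graph) (S : Subset (size G)) : Fin (size G) → Fin (size G) → Set where
  here  : ∀ {u} → u ∉ S → PathAvoiding G S u u
  step  : ∀ {u v w} → u ∉ S → Adj G u v → PathAvoiding G S v w → PathAvoiding G S u w

Connected : Graph → Set
Connected G = ∀ u v → PathAvoiding G ⊥ u v

IsClique : (G : Graph) → Subset (size G) → Set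
IsClique G S = ∀ {u v} → u ∈ S → v ∈ S → u ≢ v → Adj G u v

-- A clique separator: a clique S such that two vertices outside S lying in
-- the same component of G are in different components of G - S
-- (for connected G: G - S is disconnected).
IsCliqueSeparator : (G : Graph) → Subset (size G) → Set
IsCliqueSeparator G S =
  IsClique G S ×
  (Σ (Fin (size G)) λ u → Σ (Fin (size G)) λ v →
     u ∉ S × v ∉ S × PathAvoiding G ⊥ u v × ¬ PathAvoiding G S u v)

NoCliqueSeparator : Graph → Set
NoCliqueSeparator G = ∀ S → ¬ IsCliqueSeparator G S

IsMaximumClique : (G : Graph) → Subset (size G) → Set
IsMaximumClique G Q = IsClique G Q × (∀ S → IsClique G S → ∣ S ∣ ≤ ∣ Q ∣)

open import Relation.Nullary using (yes; no)
open import Relation.Nullary.Decidable using (_⊎-dec_; _×-dec_; ¬?)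
open import Relation.Binary.PropositionalEquality using (refl; sym; trans; subst; cong)
import Data.Nat.Properties as ℕP
import Data.Fin as F
open import Data.Sum using (inj₁; inj₂)

P5 : Graph
P5 = record
  { size = 5
  ; Adj = P5Adj
  ; adj? = λ i j → (suc (toℕ i) ℕP.≟ toℕ j) ⊎-dec (suc (toℕ j) ℕP.≟ toℕ i)
  ; sym = λ { (inj₁ e) → inj₂ e ; (inj₂ e) → inj₁ e }
  ; irrefl = λ { (inj₁ e) → ℕP.1+n≢n e
               ; (inj₂ e) → ℕP.1+n≢n e }
  }

Kminus : (p : ℕ) → Graph
Kminus p = record
  { size = p
  ; Adj = KpeAdj p
  ; adj? = λ i j → ¬? (i F.≟ j) ×-dec ¬? ((toℕ i + toℕ j) ℕP.≟ 1)
  ; sym = λ { {i} {j} (ne , n1) → (λ e → ne (Relation.Binary.PropositionalEquality.sym e))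
                                 , (λ e → n1 (trans (ℕP.+-comm (toℕ i) (toℕ j)) e)) }
  ; irrefl = λ { (ne , _) → ne refl }
  }

O3 : Graph
O3 = record
  { size = 3
  ; Adj = O3Adj
  ; adj? = λ _ _ → no (λ ())
  ; sym = λ ()
  ; irrefl = λ ()
  }

module Submission where

-- Write p = k + 2 and suppose |Q| > (p + 1)(p − 2). A vertex v outside the maximum clique Q has at
-- most p − 2 neighbours in Q: otherwise Q ∪ {v} is a larger clique, or v, a non-neighbour q ∈ Q of v
-- and p − 2 neighbours of v in Q form a K_p − e. Hence any p + 1 vertices outside Q have a common
-- non-neighbour t in Q, and P5-freeness gives a propagation rule: if s ∈ Q sees y ∉ Q but not a, b ∉ Q,
-- where y ~ a ~ b, then y ~ b (else t s y a b is an induced P5).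
-- Suppose G − Q contains an induced path u c w. As Q is not a clique separator, G − Q is connected and
-- every s ∈ Q has a neighbour outside Q. Given a clique R of common neighbours of u and w outside Q,
-- pick s ∈ Q missing u, w and R, and walk in G − Q from a neighbour of s to u: propagation yields a
-- neighbour of s adjacent to u, w and all of R. Growing R to p − 2 vertices gives an induced K_p − e.
-- So G − Q is a clique, and G, covered by two cliques, has no three independent vertices.

open import Data.Empty using (⊥; ⊥-elim)
open import Data.Fin as Fin using (Fin; zero; suc; toℕ)
open import Data.Fin.Patterns using (0F; 1F; 2F; 3F; 4F)
open import Data.Fin.Properties using (_≟_; <-cmp; <⇒≢; any?; all?; suc-injective)
open import Data.Fin.Subset
  using (Subset; inside; outside; _∈_; _∉_; _⊆_; _⊂_; _∩_; _∪_; ∁; ⁅_⁆; Nonempty; ∣_∣)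
open import Data.Fin.Subset.Properties
  using (_∈?_; nonempty?; Empty-unique; ∣⊥∣≡0; x∈p∩q⁺; x∈p∩q⁻; x∈∁p⇒x∉p;
         x∈p∪q⁻; p⊆p∪q; q⊆p∪q; x∈⁅x⁆; x∈⁅y⁆⇒x≡y; p⊆q⇒∣p∣≤∣q∣; p⊂q⇒∣p∣<∣q∣)
open import Data.Nat using (ℕ; zero; suc; _≤_; _<_; _+_; _*_; _∸_; _^_; z≤n; s≤s; _≤?_)
open import Data.Nat.Properties
  using (≤-refl; ≤-trans; ≤-reflexive; ≤-<-trans; <-≤-trans; <⇒≤; <⇒≱; ≮⇒≥; ≰⇒>; n≤1+n; m≤n+m; m≤m+n;
         +-suc; +-comm; +-monoˡ-≤; +-monoʳ-≤; +-cancelˡ-<; *-monoˡ-≤; m≤m*n; m^n≢0; module ≤-Reasoning)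
open import Data.Product using (∃; Σ; _×_; _,_; proj₁; proj₂)
open import Data.Sum using (_⊎_; inj₁; inj₂)
import Data.Sum as Sum
open import Data.Vec using (Vec; []; _∷_; lookup; tabulate; here; there)
open import Data.Vec.Relation.Unary.All using (All; []; _∷_)
import Data.Vec.Relation.Unary.All as All
open import Data.Vec.Relation.Unary.All.Properties using (tabulate⁺; tabulate⁻)
open import Function using (_∘_; const; id)
open import Function.Bundles using (_⇔_; mk⇔; Equivalence)
open import Function.Definitions using (Injective)
open import Relation.Binary.Definitions using (tri<; tri≈; tri>)
open import Relation.Binary.PropositionalEquality as ≡ using (_≡_; _≢_; refl; subst; cong; trans)
open import Relation.Nullary using (¬_; Dec; yes; no; does; contradiction)
open import Relation.Nullary.Decidable using (_×-dec_; _⊎-dec_; _→-dec_; ¬?; from-yes; from-no; decidable-stable)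
open import Relation.Nullary.Negation using (¬¬-Monad; ¬¬-map)
open import Relation.Unary using (Pred; Decidable)
open import Effect.Monad using (RawMonad)

open import Defs

open Equivalence using (to; from)

toSubset : ∀ {n p} {P : Pred (Fin n) p} → Decidable P → Subset n
toSubset {zero}  P? = []
toSubset {suc n} P? = does (P? zero) ∷ toSubset (P? ∘ suc)

∈-toSubset⁺ : ∀ {n p} {P : Pred (Fin n) p} (P? : Decidable P) {x} → P x → x ∈ toSubset P?
∈-toSubset⁺ {suc n} P? {zero} Px with P? zero
... | yes _  = here
... | no ¬Px = contradiction Px ¬Px
∈-toSubset⁺ {suc n} P? {suc x} Px = there (∈-toSubset⁺ (P? ∘ suc) Px)

∈-toSubset⁻ : ∀ {n p} {P : Pred (Fin n) p} (P? : Decidable P) {x} → x ∈ toSubset P? → P x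
∈-toSubset⁻ {suc n} P? {zero} x∈ with P? zero | x∈
... | yes Px | _ = Px
... | no _   | ()
∈-toSubset⁻ {suc n} P? {suc x} (there x∈) = ∈-toSubset⁻ (P? ∘ suc) x∈

∣p∣≡∣p∩q∣+∣p∩∁q∣ : ∀ {n} (p q : Subset n) → ∣ p ∣ ≡ ∣ p ∩ q ∣ + ∣ p ∩ ∁ q ∣
∣p∣≡∣p∩q∣+∣p∩∁q∣ []            []            = refl
∣p∣≡∣p∩q∣+∣p∩∁q∣ (outside ∷ p) (_ ∷ q)       = ∣p∣≡∣p∩q∣+∣p∩∁q∣ p q
∣p∣≡∣p∩q∣+∣p∩∁q∣ (inside  ∷ p) (inside  ∷ q) = cong suc (∣p∣≡∣p∩q∣+∣p∩∁q∣ p q)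
∣p∣≡∣p∩q∣+∣p∩∁q∣ (inside  ∷ p) (outside ∷ q) =
  trans (cong suc (∣p∣≡∣p∩q∣+∣p∩∁q∣ p q)) (≡.sym (+-suc ∣ p ∩ q ∣ ∣ p ∩ ∁ q ∣))

0<∣p∣⇒Nonempty : ∀ {n} (p : Subset n) → 0 < ∣ p ∣ → Nonempty p
0<∣p∣⇒Nonempty {n} p 0<∣p∣ = decidable-stable (nonempty? p) λ p-empty →
  <⇒≱ 0<∣p∣ (≤-reflexive (trans (cong ∣_∣ (Empty-unique p-empty)) (∣⊥∣≡0 n)))

enumerate : ∀ {n m} (p : Subset n) → m ≤ ∣ p ∣ →
            Σ (Fin m → Fin n) λ e → Injective _≡_ _≡_ e × (∀ i → e i ∈ p)
enumerate {m = zero}  p             _   = (λ ()) , (λ { {()} }) , (λ ())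
enumerate {m = suc m} (outside ∷ p) m<∣p∣ with enumerate p m<∣p∣
... | e , e-injective , e∈p = suc ∘ e , e-injective ∘ suc-injective , there ∘ e∈p
enumerate {m = suc m} (inside ∷ p) (s≤s m≤∣p∣) with enumerate p m≤∣p∣
... | e , e-injective , e∈p = e′ , e′-injective , e′∈p
  where
  e′ : Fin (suc m) → Fin (suc _)
  e′ zero    = zero
  e′ (suc i) = suc (e i)
  e′-injective : Injective _≡_ _≡_ e′
  e′-injective {zero}  {zero}  _  = refl
  e′-injective {suc i} {suc j} eq = cong suc (e-injective (suc-injective eq))
  e′∈p : ∀ i → e′ i ∈ inside ∷ p
  e′∈p zero    = here
  e′∈p (suc i) = there (e∈p i)

module _ {H G : Graph} (f : Fin (size H) → Fin (size G)) where

  ⇔-from-< : (∀ {i j} → i Fin.< j → Adj H i j ⇔ Adj G (f i) (f j)) →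
             ∀ i j → Adj H i j ⇔ Adj G (f i) (f j)
  ⇔-from-< upper i j with <-cmp i j
  ... | tri< i<j _ _  = upper i<j
  ... | tri≈ _ refl _ = mk⇔ (⊥-elim ∘ irrefl H) (⊥-elim ∘ irrefl G)
  ... | tri> _ _ j<i  = mk⇔ (sym G ∘ to (upper j<i) ∘ sym H) (sym H ∘ from (upper j<i) ∘ sym G)

TwinFree : Graph → Set
TwinFree H = ∀ i j → i ≢ j → ∃ λ k → (Adj H i k × ¬ Adj H j k) ⊎ (Adj H j k × ¬ Adj H i k)

module _ {H G : Graph} {f : Fin (size H) → Fin (size G)}
         (f-iff : ∀ i j → Adj H i j ⇔ Adj G (f i) (f j)) where

  same-image⇒same-neighbours : ∀ {i j k} → f i ≡ f j → Adj H i k → Adj H j k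
  same-image⇒same-neighbours fi≡fj ik =
    from (f-iff _ _) (subst (λ x → Adj G x (f _)) fi≡fj (to (f-iff _ _) ik))

  twin-free⇒injective : TwinFree H → Injective _≡_ _≡_ f
  twin-free⇒injective twin-free {i} {j} fi≡fj with i ≟ j
  ... | yes i≡j = i≡j
  ... | no  i≢j with twin-free i j i≢j
  ...   | _ , inj₁ (ik , ¬jk) = contradiction (same-image⇒same-neighbours fi≡fj ik) ¬jk
  ...   | _ , inj₂ (jk , ¬ik) = contradiction (same-image⇒same-neighbours (≡.sym fi≡fj) jk) ¬ik

P5-twin-free : TwinFree P5
P5-twin-free = from-yes (all? λ i → all? λ j → ¬? (i ≟ j) →-dec any? λ k →
  (adj? P5 i k ×-dec ¬? (adj? P5 j k)) ⊎-dec (adj? P5 j k ×-dec ¬? (adj? P5 i k)))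

module GraphProperties (G : Graph) where

  V : Set
  V = Fin (size G)

  infix 4 _~_
  _~_ : V → V → Set
  u ~ v = Adj G u v

  adjacent⇒≢ : ∀ {u v} → u ~ v → u ≢ v
  adjacent⇒≢ u~v refl = irrefl G u~v

  induced-P5 : ∀ {v₀ v₁ v₂ v₃ v₄} →
               v₀ ~ v₁ → v₁ ~ v₂ → v₂ ~ v₃ → v₃ ~ v₄ →
               ¬ v₀ ~ v₂ → ¬ v₀ ~ v₃ → ¬ v₀ ~ v₄ → ¬ v₁ ~ v₃ → ¬ v₁ ~ v₄ → ¬ v₂ ~ v₄ →
               HasInduced P5 G
  induced-P5 {v₀} {v₁} {v₂} {v₃} {v₄} e₀₁ e₁₂ e₂₃ e₃₄ n₀₂ n₀₃ n₀₄ n₁₃ n₁₄ n₂₄ =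
    v , twin-free⇒injective {P5} {G} v-iff P5-twin-free , v-iff
    where
    v : Fin 5 → V
    v = lookup (v₀ ∷ v₁ ∷ v₂ ∷ v₃ ∷ v₄ ∷ [])
    edge : ∀ {i j} → suc (toℕ i) ≡ toℕ j → v i ~ v j → P5Adj i j ⇔ v i ~ v j
    edge i+1≡j e = mk⇔ (const e) (const (inj₁ i+1≡j))
    gap : ∀ {i j} → ¬ P5Adj i j → ¬ v i ~ v j → P5Adj i j ⇔ v i ~ v j
    gap ¬ij n = mk⇔ (⊥-elim ∘ ¬ij) (⊥-elim ∘ n)
    upper : ∀ {i j} → i Fin.< j → P5Adj i j ⇔ v i ~ v j
    upper {0F} {1F} _ = edge refl e₀₁
    upper {0F} {2F} _ = gap (from-no (adj? P5 0F 2F)) n₀₂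
    upper {0F} {3F} _ = gap (from-no (adj? P5 0F 3F)) n₀₃
    upper {0F} {4F} _ = gap (from-no (adj? P5 0F 4F)) n₀₄
    upper {1F} {2F} _ = edge refl e₁₂
    upper {1F} {3F} _ = gap (from-no (adj? P5 1F 3F)) n₁₃
    upper {1F} {4F} _ = gap (from-no (adj? P5 1F 4F)) n₁₄
    upper {2F} {3F} _ = edge refl e₂₃
    upper {2F} {4F} _ = gap (from-no (adj? P5 2F 4F)) n₂₄
    upper {3F} {4F} _ = edge refl e₃₄
    upper {_}                 {0F} ()
    upper {suc _}             {1F} (s≤s ())
    upper {suc (suc _)}       {2F} (s≤s (s≤s ()))
    upper {suc (suc (suc _))} {3F} (s≤s (s≤s (s≤s ())))
    upper {4F}                {4F} (s≤s (s≤s (s≤s (s≤s ()))))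
    v-iff : ∀ i j → P5Adj i j ⇔ v i ~ v j
    v-iff = ⇔-from-< {P5} {G} v upper

  induced-Kminus : ∀ {k u w} (R : Fin k → V) → u ≢ w → ¬ u ~ w →
                   (∀ i → R i ~ u) → (∀ i → R i ~ w) → (∀ {i j} → i ≢ j → R i ~ R j) →
                   HasInduced (Kminus (2 + k)) G
  induced-Kminus {k} {u} {w} R u≢w u≁w R~u R~w R-clique =
    f , f-injective , ⇔-from-< {Kminus (2 + k)} {G} f upper
    where
    f : Fin (2 + k) → V
    f 0F            = u
    f 1F            = w
    f (suc (suc i)) = R i
    upper : ∀ {i j} → i Fin.< j → KpeAdj (2 + k) i j ⇔ f i ~ f j
    upper {0F}          {1F}          _   = mk⇔ (λ (_ , ≢1) → contradiction refl ≢1) (⊥-elim ∘ u≁w)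
    upper {0F}          {suc (suc j)} _   = mk⇔ (const (sym G (R~u j))) (const ((λ ()) , (λ ())))
    upper {1F}          {suc (suc j)} _   = mk⇔ (const (sym G (R~w j))) (const ((λ ()) , (λ ())))
    upper {suc (suc i)} {suc (suc j)} i<j =
      mk⇔ (const (R-clique (<⇒≢ i<j ∘ cong (Fin.suc ∘ Fin.suc)))) (const (<⇒≢ i<j , (λ ())))
    upper {_}           {0F}          ()
    upper {suc _}       {1F}          (s≤s ())
    f-injective : Injective _≡_ _≡_ f
    f-injective {0F}          {0F}          _  = refl
    f-injective {0F}          {1F}          eq = contradiction eq u≢w
    f-injective {0F}          {suc (suc j)} eq = contradiction (≡.sym eq) (adjacent⇒≢ (R~u j))
    f-injective {1F}          {0F}          eq = contradiction (≡.sym eq) u≢w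
    f-injective {1F}          {1F}          _  = refl
    f-injective {1F}          {suc (suc j)} eq = contradiction (≡.sym eq) (adjacent⇒≢ (R~w j))
    f-injective {suc (suc i)} {0F}          eq = contradiction eq (adjacent⇒≢ (R~u i))
    f-injective {suc (suc i)} {1F}          eq = contradiction eq (adjacent⇒≢ (R~w i))
    f-injective {suc (suc i)} {suc (suc j)} eq with i ≟ j
    ... | yes i≡j = cong (Fin.suc ∘ Fin.suc) i≡j
    ... | no  i≢j = contradiction eq (adjacent⇒≢ (R-clique i≢j))

  N : V → Subset (size G)
  N v = toSubset (adj? G v)

  clique-neighbours⇒Kminus : ∀ {k C v q} → IsClique G C → v ∉ C → q ∈ C → ¬ v ~ q →
                             k ≤ ∣ C ∩ N v ∣ → HasInduced (Kminus (2 + k)) G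
  clique-neighbours⇒Kminus {C = C} {v} {q} C-clique v∉C q∈C v≁q k≤∣C∩Nv∣
    with enumerate (C ∩ N v) k≤∣C∩Nv∣
  ... | R , R-injective , R∈C∩Nv = induced-Kminus R v≢q v≁q R~v R~q R-clique
    where
    R∈C : ∀ i → R i ∈ C
    R∈C i = proj₁ (x∈p∩q⁻ C (N v) (R∈C∩Nv i))
    R~v : ∀ i → R i ~ v
    R~v i = sym G (∈-toSubset⁻ (adj? G v) (proj₂ (x∈p∩q⁻ C (N v) (R∈C∩Nv i))))
    R~q : ∀ i → R i ~ q
    R~q i = C-clique (R∈C i) q∈C λ Ri≡q → v≁q (subst (v ~_) Ri≡q (sym G (R~v i)))
    R-clique : ∀ {i j} → i ≢ j → R i ~ R j
    R-clique i≢j = C-clique (R∈C _) (R∈C _) (i≢j ∘ R-injective)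
    v≢q : v ≢ q
    v≢q refl = v∉C q∈C

  maximum-clique-undominated : ∀ {Q v} → IsMaximumClique G Q → v ∉ Q → ¬ (∀ {q} → q ∈ Q → v ~ q)
  maximum-clique-undominated {Q} {v} (Q-clique , Q-maximum) v∉Q v~Q =
    <⇒≱ (p⊂q⇒∣p∣<∣q∣ Q⊂Q′) (Q-maximum Q′ Q′-clique)
    where
    Q′ = Q ∪ ⁅ v ⁆
    Q⊂Q′ : Q ⊂ Q′
    Q⊂Q′ = p⊆p∪q ⁅ v ⁆ , v , q⊆p∪q Q ⁅ v ⁆ (x∈⁅x⁆ v) , v∉Q
    Q′-members : ∀ {x} → x ∈ Q′ → x ∈ Q ⊎ x ≡ v
    Q′-members x∈Q′ = Sum.map₂ (x∈⁅y⁆⇒x≡y v) (x∈p∪q⁻ Q ⁅ v ⁆ x∈Q′)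
    Q′-clique : IsClique G Q′
    Q′-clique x∈Q′ y∈Q′ x≢y with Q′-members x∈Q′ | Q′-members y∈Q′
    ... | inj₁ x∈Q | inj₁ y∈Q = Q-clique x∈Q y∈Q x≢y
    ... | inj₁ x∈Q | inj₂ refl = sym G (v~Q x∈Q)
    ... | inj₂ refl | inj₁ y∈Q = v~Q y∈Q
    ... | inj₂ refl | inj₂ refl = contradiction refl x≢y

  few-clique-neighbours : ∀ {k Q v} → Free (Kminus (2 + k)) G → IsMaximumClique G Q →
                          v ∉ Q → ∣ Q ∩ N v ∣ ≤ k
  few-clique-neighbours {v = v} Kminus-free Q-maximum v∉Q = ≮⇒≥ λ k<∣Q∩Nv∣ →
    maximum-clique-undominated Q-maximum v∉Q λ {q} q∈Q →
      decidable-stable (adj? G v q) λ v≁q →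
        Kminus-free (clique-neighbours⇒Kminus (proj₁ Q-maximum) v∉Q q∈Q v≁q (<⇒≤ k<∣Q∩Nv∣))

  common-non-neighbour : ∀ {k l} (S : Subset (size G)) (vs : Vec V l) →
                         All (λ v → ∣ S ∩ N v ∣ ≤ k) vs → ∀ {T} → T ⊆ S → l * k < ∣ T ∣ →
                         ∃ λ t → t ∈ T × All (λ v → ¬ t ~ v) vs
  common-non-neighbour S []       _              {T} _   0<∣T∣ =
    let t , t∈T = 0<∣p∣⇒Nonempty T 0<∣T∣ in t , t∈T , []
  common-non-neighbour {k} {suc l} S (v ∷ vs) (few ∷ fews) {T} T⊆S large =
    let t , t∈T′ , t≁vs = common-non-neighbour S vs fews T′⊆S l*k<∣T′∣
        t∈T , t∈∁Nv = x∈p∩q⁻ T (∁ (N v)) t∈T′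
    in t , t∈T , (λ t~v → x∈∁p⇒x∉p t∈∁Nv (∈-toSubset⁺ (adj? G v) (sym G t~v))) ∷ t≁vs
    where
    open ≤-Reasoning
    T′ = T ∩ ∁ (N v)
    T′⊆S : T′ ⊆ S
    T′⊆S = T⊆S ∘ proj₁ ∘ x∈p∩q⁻ T _
    T∩Nv⊆S∩Nv : T ∩ N v ⊆ S ∩ N v
    T∩Nv⊆S∩Nv x∈ = let x∈T , x∈Nv = x∈p∩q⁻ T (N v) x∈ in x∈p∩q⁺ (T⊆S x∈T , x∈Nv)
    l*k<∣T′∣ : l * k < ∣ T′ ∣
    l*k<∣T′∣ = +-cancelˡ-< k _ _ (<-≤-trans large (begin
      ∣ T ∣                ≡⟨ ∣p∣≡∣p∩q∣+∣p∩∁q∣ T (N v) ⟩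
      ∣ T ∩ N v ∣ + ∣ T′ ∣ ≤⟨ +-monoˡ-≤ ∣ T′ ∣ (≤-trans (p⊆q⇒∣p∣≤∣q∣ T∩Nv⊆S∩Nv) few) ⟩
      k + ∣ T′ ∣           ∎))

  path-source∉ : ∀ {S u v} → PathAvoiding G S u v → u ∉ S
  path-source∉ (here u∉S)     = u∉S
  path-source∉ (step u∉S _ _) = u∉S

  path-target∉ : ∀ {S u v} → PathAvoiding G S u v → v ∉ S
  path-target∉ (here v∉S)    = v∉S
  path-target∉ (step _ _ w⇝v) = path-target∉ w⇝v

  record InducedP3 (S : Subset (size G)) : Set where
    field
      u c w : V
      u∉S   : u ∉ S
      c∉S   : c ∉ S
      w∉S   : w ∉ S
      u~c   : u ~ c
      c~w   : c ~ w
      u≁w   : ¬ u ~ w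
      u≢w   : u ≢ w

  path⇒induced-P3 : ∀ {S a b} → PathAvoiding G S a b → a ≢ b → ¬ a ~ b → InducedP3 S
  path⇒induced-P3 (here _) a≢b _ = contradiction refl a≢b
  path⇒induced-P3 {b = b} (step {v = v} a∉S a~v v⇝b) a≢b a≁b with v ≟ b | adj? G v b
  ... | yes refl | _       = contradiction a~v a≁b
  ... | no  v≢b  | yes v~b = record
    { u∉S = a∉S ; c∉S = path-source∉ v⇝b ; w∉S = path-target∉ v⇝b
    ; u~c = a~v ; c~w = v~b ; u≁w = a≁b ; u≢w = a≢b }
  ... | no  v≢b  | no  v≁b = path⇒induced-P3 v⇝b v≢b v≁b

  module _ (connected : Connected G) (no-separator : NoCliqueSeparator G)
           {C : Subset (size G)} (C-clique : IsClique G C) where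

    outside-connected : ∀ {a b} → a ∉ C → b ∉ C → ¬ ¬ PathAvoiding G C a b
    outside-connected a∉C b∉C no-path =
      no-separator C (C-clique , _ , _ , a∉C , b∉C , connected _ _ , no-path)

    outside-neighbour : ∀ {q a} → q ∈ C → a ∉ C → ∃ λ r → r ∉ C × q ~ r
    outside-neighbour {q} {a} q∈C a∉C =
      decidable-stable (any? λ r → ¬? (r ∈? C) ×-dec adj? G q r) λ no-outside-neighbour →
        no-separator C′ (C′-clique , q , a , q∉C′ , a∉C′ , connected q a ,
                         no-path-from-q no-outside-neighbour a∉C)
      where
      C′ = toSubset (λ x → x ∈? C ×-dec ¬? (x ≟ q))
      C′-clique : IsClique G C′
      C′-clique x∈C′ y∈C′ = C-clique (proj₁ (∈-toSubset⁻ _ x∈C′)) (proj₁ (∈-toSubset⁻ _ y∈C′))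
      q∉C′ : q ∉ C′
      q∉C′ q∈C′ = proj₂ (∈-toSubset⁻ _ q∈C′) refl
      a∉C′ : a ∉ C′
      a∉C′ a∈C′ = a∉C (proj₁ (∈-toSubset⁻ _ a∈C′))
      no-path-from-q : ¬ (∃ λ r → r ∉ C × q ~ r) → ∀ {b} → b ∉ C → ¬ PathAvoiding G C′ q b
      no-path-from-q _ b∉C (here _) = b∉C q∈C
      no-path-from-q no-outside-neighbour _ (step {v = v} _ q~v v⇝b) =
        no-outside-neighbour (v , v∉C , q~v)
        where
        v∉C : v ∉ C
        v∉C v∈C = path-source∉ v⇝b (∈-toSubset⁺ _ (v∈C , adjacent⇒≢ q~v ∘ ≡.sym))

  split⇒O3-free : ∀ {Q} → IsClique G Q → (∀ {a b} → a ∉ Q → b ∉ Q → a ≢ b → a ~ b) → Free O3 G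
  split⇒O3-free {Q} Q-clique Qᶜ-clique (f , f-injective , f-iff) =
    two-on-one-side (f 0F ∈? Q) (f 1F ∈? Q) (f 2F ∈? Q)
    where
    no-edge : ∀ {i j} → f i ~ f j → ⊥
    no-edge = from (f-iff _ _)
    distinct : ∀ {i j} → i ≢ j → f i ≢ f j
    distinct i≢j = i≢j ∘ f-injective
    both-in : ∀ i j → i ≢ j → f i ∈ Q → f j ∈ Q → ⊥
    both-in i j i≢j fi∈Q fj∈Q = no-edge (Q-clique fi∈Q fj∈Q (distinct i≢j))
    both-out : ∀ i j → i ≢ j → f i ∉ Q → f j ∉ Q → ⊥
    both-out i j i≢j fi∉Q fj∉Q = no-edge (Qᶜ-clique fi∉Q fj∉Q (distinct i≢j))
    two-on-one-side : Dec (f 0F ∈ Q) → Dec (f 1F ∈ Q) → Dec (f 2F ∈ Q) → ⊥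
    two-on-one-side (yes f₀∈Q) (yes f₁∈Q) _          = both-in  0F 1F (λ ()) f₀∈Q f₁∈Q
    two-on-one-side (no  f₀∉Q) (no  f₁∉Q) _          = both-out 0F 1F (λ ()) f₀∉Q f₁∉Q
    two-on-one-side (yes f₀∈Q) (no  _)    (yes f₂∈Q) = both-in  0F 2F (λ ()) f₀∈Q f₂∈Q
    two-on-one-side (no  f₀∉Q) (yes _)    (no  f₂∉Q) = both-out 0F 2F (λ ()) f₀∉Q f₂∉Q
    two-on-one-side (yes _)    (no  f₁∉Q) (no  f₂∉Q) = both-out 1F 2F (λ ()) f₁∉Q f₂∉Q
    two-on-one-side (no  _)    (yes f₁∈Q) (yes f₂∈Q) = both-in  1F 2F (λ ()) f₁∈Q f₂∈Q

module LargeMaximumClique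
  (k : ℕ) {G : Graph} (connected : Connected G) (P5-free : Free P5 G)
  (Kminus-free : Free (Kminus (2 + k)) G) (no-separator : NoCliqueSeparator G)
  {Q : Subset (size G)} (Q-maximum : IsMaximumClique G Q) (Q-large : (3 + k) * k < ∣ Q ∣)
  where

  open GraphProperties G

  Q-clique : IsClique G Q
  Q-clique = proj₁ Q-maximum

  common-non-neighbour-in-Q : ∀ {l} (vs : Vec V l) → l ≤ 3 + k → All (_∉ Q) vs →
                              ∃ λ t → t ∈ Q × All (λ v → ¬ t ~ v) vs
  common-non-neighbour-in-Q vs l≤3+k vs∉Q =
    common-non-neighbour Q vs (All.map (few-clique-neighbours Kminus-free Q-maximum) vs∉Q)
                         id (≤-<-trans (*-monoˡ-≤ k l≤3+k) Q-large)

  -- Otherwise t s y a b is an induced P5, for t ∈ Q a common non-neighbour of y, a and b.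
  propagate : ∀ {s y a b} → s ∈ Q → y ∉ Q → a ∉ Q → b ∉ Q →
              s ~ y → y ~ a → a ~ b → ¬ s ~ a → ¬ s ~ b → y ~ b
  propagate {s} {y} {a} {b} s∈Q y∉Q a∉Q b∉Q s~y y~a a~b s≁a s≁b with adj? G y b
  ... | yes y~b = y~b
  ... | no  y≁b with common-non-neighbour-in-Q (y ∷ a ∷ b ∷ []) (m≤m+n 3 k) (y∉Q ∷ a∉Q ∷ b∉Q ∷ [])
  ...   | t , t∈Q , t≁y ∷ t≁a ∷ t≁b ∷ [] =
    ⊥-elim (P5-free (induced-P5 t~s s~y y~a a~b t≁y t≁a t≁b s≁a s≁b y≁b))
    where
    t~s : t ~ s
    t~s = Q-clique t∈Q s∈Q λ t≡s → t≁y (subst (_~ y) (≡.sym t≡s) s~y)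

  module _ {s u} (s∈Q : s ∈ Q) (s≁u : ¬ s ~ u) where

    -- Walk along the path; y is the last vertex seen by s so far, and propagate keeps it
    -- adjacent to the current vertex.
    path⇒common-neighbour : ∀ {y} → y ∉ Q → s ~ y → PathAvoiding G Q y u →
                            ∃ λ z → z ∉ Q × s ~ z × z ~ u
    path⇒common-neighbour′ : ∀ {y v} → y ∉ Q → s ~ y → y ~ v → ¬ s ~ v → PathAvoiding G Q v u →
                             ∃ λ z → z ∉ Q × s ~ z × z ~ u

    path⇒common-neighbour _ s~y (here _) = contradiction s~y s≁u
    path⇒common-neighbour y∉Q s~y (step {v = v} _ y~v v⇝u) with adj? G s v
    ... | yes s~v = path⇒common-neighbour (path-source∉ v⇝u) s~v v⇝u
    ... | no  s≁v = path⇒common-neighbour′ y∉Q s~y y~v s≁v v⇝u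

    path⇒common-neighbour′ y∉Q s~y y~u _ (here _) = _ , y∉Q , s~y , y~u
    path⇒common-neighbour′ y∉Q s~y y~v s≁v (step {v = v′} v∉Q v~v′ v′⇝u) with adj? G s v′
    ... | yes s~v′ = path⇒common-neighbour (path-source∉ v′⇝u) s~v′ v′⇝u
    ... | no  s≁v′ = path⇒common-neighbour′ y∉Q s~y
                       (propagate s∈Q y∉Q v∉Q (path-source∉ v′⇝u) s~y y~v v~v′ s≁v s≁v′) s≁v′ v′⇝u

  module Growth (P : InducedP3 Q) where

    open InducedP3 P renaming (u∉S to u∉Q; c∉S to c∉Q; w∉S to w∉Q)

    record CommonClique (m : ℕ) : Set where
      field
        R        : Fin m → V
        R∉Q      : ∀ i → R i ∉ Q
        R~u      : ∀ i → R i ~ u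
        R~w      : ∀ i → R i ~ w
        R-clique : ∀ {i j} → i ≢ j → R i ~ R j

    no-common-clique : ¬ CommonClique k
    no-common-clique K = Kminus-free (induced-Kminus R u≢w u≁w R~u R~w R-clique)
      where open CommonClique K

    empty : CommonClique 0
    empty = record { R = λ () ; R∉Q = λ () ; R~u = λ () ; R~w = λ () ; R-clique = λ { {()} } }

    centre : CommonClique 1
    centre = record
      { R = const c ; R∉Q = const c∉Q ; R~u = const (sym G u~c) ; R~w = const c~w
      ; R-clique = λ { {0F} {0F} 0≢0 → contradiction refl 0≢0 } }

    module Extension {m} (m≤k : m ≤ k) (K : CommonClique (suc m)) where

      open CommonClique K

      add : ∀ {s y} → s ∈ Q → ¬ s ~ u → ¬ s ~ w → (∀ i → ¬ s ~ R i) →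
            y ∉ Q → s ~ y → y ~ u → CommonClique (suc (suc m))
      add {y = y} s∈Q s≁u s≁w s≁R y∉Q s~y y~u = record
        { R        = R′
        ; R∉Q      = λ { 0F → y∉Q ; (suc i) → R∉Q i }
        ; R~u      = λ { 0F → y~u ; (suc i) → R~u i }
        ; R~w      = λ { 0F → y~w ; (suc i) → R~w i }
        ; R-clique = R′-clique
        }
        where
        y~R : ∀ i → y ~ R i
        y~R i = propagate s∈Q y∉Q u∉Q (R∉Q i) s~y y~u (sym G (R~u i)) s≁u (s≁R i)
        y~w : y ~ w
        y~w = propagate s∈Q y∉Q (R∉Q 0F) w∉Q s~y (y~R 0F) (R~w 0F) (s≁R 0F) s≁w
        R′ : Fin (suc (suc m)) → V
        R′ 0F      = y
        R′ (suc i) = R i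
        R′-clique : ∀ {i j} → i ≢ j → R′ i ~ R′ j
        R′-clique {0F}    {0F}    0≢0 = contradiction refl 0≢0
        R′-clique {0F}    {suc j} _   = y~R j
        R′-clique {suc i} {0F}    _   = sym G (y~R i)
        R′-clique {suc i} {suc j} i≢j = R-clique (i≢j ∘ cong suc)

      extended : ¬ ¬ CommonClique (suc (suc m))
      extended with common-non-neighbour-in-Q (u ∷ w ∷ tabulate R) (+-monoʳ-≤ 3 m≤k)
                                              (u∉Q ∷ w∉Q ∷ tabulate⁺ R∉Q)
      ... | s , s∈Q , s≁u ∷ s≁w ∷ s≁R with outside-neighbour connected no-separator Q-clique s∈Q u∉Q
      ...   | r , r∉Q , s~r = ¬¬-map grow (outside-connected connected no-separator Q-clique r∉Q u∉Q)
        where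
        grow : PathAvoiding G Q r u → CommonClique (suc (suc m))
        grow r⇝u = let y , y∉Q , s~y , y~u = path⇒common-neighbour s∈Q s≁u r∉Q s~r r⇝u
                   in add s∈Q s≁u s≁w (tabulate⁻ s≁R) y∉Q s~y y~u

    common-clique : ∀ m → m ≤ k → ¬ ¬ CommonClique m
    common-clique 0             _     = λ no → no empty
    common-clique 1             _     = λ no → no centre
    common-clique (suc (suc m)) 2+m≤k =
      common-clique (suc m) (≤-trans (n≤1+n _) 2+m≤k)
        >>= Extension.extended (≤-trans (m≤n+m m 2) 2+m≤k)
      where open RawMonad ¬¬-Monad

  no-induced-P3 : ¬ InducedP3 Q
  no-induced-P3 P = common-clique k ≤-refl no-common-clique
    where open Growth P

  outside-clique : ∀ {a b} → a ∉ Q → b ∉ Q → a ≢ b → a ~ b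
  outside-clique {a} {b} a∉Q b∉Q a≢b = decidable-stable (adj? G a b) λ a≁b →
    outside-connected connected no-separator Q-clique a∉Q b∉Q λ a⇝b →
      no-induced-P3 (path⇒induced-P3 a⇝b a≢b a≁b)

  O3-free : Free O3 G
  O3-free = split⇒O3-free Q-clique outside-clique

clique-bound : ∀ k → (3 + k) * k ≤ (2 + k + 1) ^ (2 + k + 2) * (2 + k ∸ 2)
clique-bound k = *-monoˡ-≤ k (begin
  3 + k                         ≡⟨ +-comm 1 (2 + k) ⟩
  2 + k + 1                     ≤⟨ m≤m*n _ _ {{m^n≢0 (2 + k + 1) (1 + k + 2)}} ⟩
  (2 + k + 1) ^ (2 + k + 2)     ∎)
  where open ≤-Reasoning

lemma4 : (p : ℕ) → 3 ≤ p → (G : Graph) → Connected G →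
         Free P5 G → Free (Kminus p) G → NoCliqueSeparator G →
         (Q : Subset (size G)) → IsMaximumClique G Q →
         Free O3 G ⊎ ∣ Q ∣ ≤ (p + 1) ^ (p + 2) * (p ∸ 2)
lemma4 (suc (suc (suc k))) (s≤s (s≤s (s≤s z≤n))) G
       connected P5-free Kminus-free no-separator Q Q-maximum
  with ∣ Q ∣ ≤? (3 + k + 1) ^ (3 + k + 2) * suc k
... | yes small = inj₂ small
... | no  large = inj₁ (O3-free (≤-<-trans (clique-bound (suc k)) (≰⇒> large)))
  where open LargeMaximumClique (suc k) connected P5-free Kminus-free no-separator Q-maximum
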